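{- Let $\lambda$ be a nonzero real number and let $n\ge r\ge 0$ be integers. Then $$S_\lambda(n+1,r+1)=\frac{n!}{r!}\,\lambda^{n-r}\,Bel_r\Big(H_n^{(1)},\,(-1)\,1!\,H_n^{(2)},\,\dots,\,(-1)^{r-1}(r-1)!\,H_n^{(r)}\Big),$$ where $H_n^{(i)}=\sum_{k=1}^n \frac{1}{k^i}$ is the harmonic number of order $i$.
   Context: For real $\lambda$, the degenerate rising factorials are $\langle x\rangle_{0,\lambda}=1$ and $\langle x\rangle_{n,\lambda}=x(x+\lambda)(x+2\lambda)\cdots(x+(n-1)\lambda)$ for $n\ge1$. The unsigned degenerate Stirling numbers of the first kind $S_\lambda(n,k)$ are defined by $\langle x\rangle_{n,\lambda}=\sum_{k=0}^n S_\lambda(n,k)x^k$. The complete Bell polynomials $Bel_r(x_1,\dots,x_r)$ are defined by $\exp\big(\sum_{j\ge1}x_j\frac{t^j}{j!}\big)=\sum_{r\ge0}Bel_r(x_1,\dots,x_r)\frac{t^r}{r!}$; equivalently $Bel_r(x_1,\dots,x_r)=\sum_{k_1+2k_2+\cdots+rk_r=r}\frac{r!}{k_1!\cdots k_r!}\prod_{j=1}^r\big(\frac{x_j}{j!}\big)^{k_j}$ (so $Bel_0=1$).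
   Formalization: The parameter λ ranges over the nonzero rationals instead of the nonzero reals. -}

module Defs where

open import Data.Nat as ℕ using (ℕ; zero; suc; _!; _∸_)
open import Data.Integer using (+_)
open import Data.Rational using (ℚ; 0ℚ; 1ℚ; _+_; _*_; -_; _/_)
open import Data.List using (List; []; _∷_; map)

ℕ→ℚ : ℕ → ℚ
ℕ→ℚ m = + m / 1

-- 1/m for m ≥ 1 (only ever applied to positive m; value at 0 is irrelevant)
invℕ : ℕ → ℚ
invℕ zero    = 0ℚ
invℕ (suc k) = + 1 / suc k

_^ℚ_ : ℚ → ℕ → ℚ
q ^ℚ zero  = 1ℚ
q ^ℚ suc m = q * (q ^ℚ m)

sum1 : ℕ → (ℕ → ℚ) → ℚ
sum1 zero    f = 0ℚ
sum1 (suc n) f = sum1 n f + f (suc n)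

-- Polynomials (in one variable) over ℚ as coefficient lists, constant first

Poly : Set
Poly = List ℚ

addP : Poly → Poly → Poly
addP []       q        = q
addP (a ∷ p)  []       = a ∷ p
addP (a ∷ p)  (b ∷ q)  = (a + b) ∷ addP p q

scaleP : ℚ → Poly → Poly
scaleP c p = map (c *_) p

mulP : Poly → Poly → Poly
mulP []      q = []
mulP (a ∷ p) q = addP (scaleP a q) (0ℚ ∷ mulP p q)

coeff : Poly → ℕ → ℚ
coeff []      k       = 0ℚ
coeff (a ∷ p) zero    = a
coeff (a ∷ p) (suc k) = coeff p k

linP : ℚ → Poly
linP c = c ∷ 1ℚ ∷ []

risingλ : ℚ → ℕ → Poly
risingλ λ′ zero    = 1ℚ ∷ []
risingλ λ′ (suc n) = mulP (risingλ λ′ n) (linP (ℕ→ℚ n * λ′))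

Sλ : ℚ → ℕ → ℕ → ℚ
Sλ λ′ n k = coeff (risingλ λ′ n) k

-- Complete Bell polynomials via the generating function
--   exp(Σ_{j≥1} x_j t^j / j!) = Σ_r Bel_r t^r / r!
-- Since f = Σ_{j≥1} x_j t^j/j! has no constant term, the coefficient of t^r
-- in exp f only involves f^m/m! for m ≤ r and the terms x_j with j ≤ r.
-- The argument x : ℕ → ℚ is read as j ↦ x_j (only j = 1,…,r are used).

fPoly : ℕ → (ℕ → ℚ) → Poly
fPoly r x = 0ℚ ∷ go 1 r
  where
  go : ℕ → ℕ → Poly
  go j zero    = []
  go j (suc m) = (x j * invℕ (j !)) ∷ go (suc j) m

powP : Poly → ℕ → Poly
powP p zero    = 1ℚ ∷ []
powP p (suc m) = mulP p (powP p m)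

expTrunc : ℕ → Poly → Poly
expTrunc zero    p = 1ℚ ∷ []
expTrunc (suc m) p = addP (expTrunc m p) (scaleP (invℕ (suc m !)) (powP p (suc m)))

Bel : (r : ℕ) → (ℕ → ℚ) → ℚ
Bel r x = ℕ→ℚ (r !) * coeff (expTrunc r (fPoly r x)) r

H : ℕ → ℕ → ℚ
H n i = sum1 n (λ k → invℕ (k ℕ.^ i))

sgn : ℕ → ℚ
sgn m = (- 1ℚ) ^ℚ m

{-# OPTIONS --safe #-}
-- Since ⟨x⟩_{n+1,λ} = x ∏_{m=1}^{n} (x + mλ), the number S_λ(n+1, r+1) is n! λ^{n-r} e_r(1, 1/2, …, 1/n),
-- the coefficient of t^r in E(t) = ∏_{m ≤ n} (1 + t/m).
-- Now log E = Σ_j (-1)^{j-1} H_n^{(j)} t^j / j = Σ_j x_j t^j / j! for the arguments x_j of the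
-- theorem, so E = exp(Σ_j x_j t^j / j!) and e_r = Bel_r(x)/r!.  Formally: with θ = t d/dt, both E and
-- the truncated exponential defining Bel_r satisfy θX = (θ log E)·X (for E these are Newton's
-- identities), and a solution of this equation is determined by its constant term.
module Submission where

open import Defs
open import Data.Nat using (ℕ; suc; _≤_; _!; _∸_)
open import Data.Rational using (ℚ; 0ℚ; _*_)
open import Relation.Binary.PropositionalEquality using (_≡_; _≢_)

open import Data.Nat using (zero; _<_; z≤n; s≤s; NonZero; _^_)
open import Data.Nat.Properties using (_!≢0; m^n≢0)
import Data.Nat as ℕ
import Data.Nat.Properties as ℕ
import Data.Nat.Coprimality as Coprimality
import Data.Integer as ℤ
import Data.Integer.Properties as ℤ
open import Data.Rational using (1ℚ; _+_; -_; mkℚ)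
open import Data.List using ([]; _∷_; drop)
open import Data.Sum using (inj₁; inj₂)
import Data.Rational.Properties as ℚ
import Data.Rational.Unnormalised as ℚᵘ
import Data.Rational.Unnormalised.Properties as ℚᵘ
open import Relation.Binary.PropositionalEquality
  using (refl; sym; trans; cong; cong₂; _≗_; module ≡-Reasoning)
open import Data.Rational.Solver using (module +-*-Solver)
open +-*-Solver
open ≡-Reasoning

coprime-1 : ∀ m → Coprimality.Coprime m 1
coprime-1 m = Coprimality.sym (Coprimality.1-coprimeTo m)

ℕ→ℚ≡mkℚ : ∀ m → ℕ→ℚ m ≡ mkℚ (ℤ.+ m) 0 (coprime-1 m)
ℕ→ℚ≡mkℚ m = ℚ.normalize-coprime (coprime-1 m)

ℕ→ℚ-suc : ∀ m → ℕ→ℚ (suc m) ≡ 1ℚ + ℕ→ℚ m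
ℕ→ℚ-suc m rewrite ℕ→ℚ≡mkℚ (suc m) | ℕ→ℚ≡mkℚ m = ℚ.toℚᵘ-injective (ℚᵘ.≃-sym (ℚᵘ.≃-trans
  (ℚ.toℚᵘ-homo-+ 1ℚ (mkℚ (ℤ.+ m) 0 (coprime-1 m)))
  (ℚᵘ.*≡* (cong (ℤ._* ℤ.1ℤ) (cong (ℤ._+_ ℤ.1ℤ) (ℤ.*-identityʳ (ℤ.+ m)))))))

ℕ→ℚ-+ : ∀ a b → ℕ→ℚ (a ℕ.+ b) ≡ ℕ→ℚ a + ℕ→ℚ b
ℕ→ℚ-+ zero    b = sym (ℚ.+-identityˡ (ℕ→ℚ b))
ℕ→ℚ-+ (suc a) b = begin
  ℕ→ℚ (suc (a ℕ.+ b))    ≡⟨ ℕ→ℚ-suc (a ℕ.+ b) ⟩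
  1ℚ + ℕ→ℚ (a ℕ.+ b)     ≡⟨ cong (1ℚ +_) (ℕ→ℚ-+ a b) ⟩
  1ℚ + (ℕ→ℚ a + ℕ→ℚ b)   ≡⟨ ℚ.+-assoc 1ℚ (ℕ→ℚ a) (ℕ→ℚ b) ⟨
  (1ℚ + ℕ→ℚ a) + ℕ→ℚ b   ≡⟨ cong (_+ ℕ→ℚ b) (ℕ→ℚ-suc a) ⟨
  ℕ→ℚ (suc a) + ℕ→ℚ b    ∎

ℕ→ℚ-* : ∀ a b → ℕ→ℚ (a ℕ.* b) ≡ ℕ→ℚ a * ℕ→ℚ b
ℕ→ℚ-* zero    b = sym (ℚ.*-zeroˡ (ℕ→ℚ b))
ℕ→ℚ-* (suc a) b = begin
  ℕ→ℚ (b ℕ.+ a ℕ.* b)       ≡⟨ ℕ→ℚ-+ b (a ℕ.* b) ⟩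
  ℕ→ℚ b + ℕ→ℚ (a ℕ.* b)     ≡⟨ cong (ℕ→ℚ b +_) (ℕ→ℚ-* a b) ⟩
  ℕ→ℚ b + ℕ→ℚ a * ℕ→ℚ b     ≡⟨ solve 2 (λ x y → y :+ x :* y := (con 1ℚ :+ x) :* y) refl (ℕ→ℚ a) (ℕ→ℚ b) ⟩
  (1ℚ + ℕ→ℚ a) * ℕ→ℚ b      ≡⟨ cong (_* ℕ→ℚ b) (ℕ→ℚ-suc a) ⟨
  ℕ→ℚ (suc a) * ℕ→ℚ b       ∎

ℕ→ℚ-^ : ∀ a j → ℕ→ℚ (a ^ j) ≡ ℕ→ℚ a ^ℚ j
ℕ→ℚ-^ a zero    = refl
ℕ→ℚ-^ a (suc j) = trans (ℕ→ℚ-* a (a ^ j)) (cong (ℕ→ℚ a *_) (ℕ→ℚ-^ a j))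

^ℚ-distrib-* : ∀ x y j → (x * y) ^ℚ j ≡ (x ^ℚ j) * (y ^ℚ j)
^ℚ-distrib-* x y zero    = refl
^ℚ-distrib-* x y (suc j) = begin
  (x * y) * ((x * y) ^ℚ j)          ≡⟨ cong ((x * y) *_) (^ℚ-distrib-* x y j) ⟩
  (x * y) * ((x ^ℚ j) * (y ^ℚ j))   ≡⟨ solve 4 (λ a b c d → (a :* b) :* (c :* d) := (a :* c) :* (b :* d)) refl x y (x ^ℚ j) (y ^ℚ j) ⟩
  (x * (x ^ℚ j)) * (y * (y ^ℚ j))   ∎

1^ℚ : ∀ j → 1ℚ ^ℚ j ≡ 1ℚ
1^ℚ zero    = refl
1^ℚ (suc j) = trans (ℚ.*-identityˡ (1ℚ ^ℚ j)) (1^ℚ j)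

invℕ-inverseˡ : ∀ n .{{_ : NonZero n}} → invℕ n * ℕ→ℚ n ≡ 1ℚ
invℕ-inverseˡ (suc k) rewrite ℕ→ℚ≡mkℚ (suc k) | ℚ.normalize-coprime (Coprimality.1-coprimeTo (suc k)) =
  ℚ.*-inverseˡ (mkℚ (ℤ.+ suc k) 0 (coprime-1 (suc k)))

invℕ-unique : ∀ n .{{_ : NonZero n}} {u} → u * ℕ→ℚ n ≡ 1ℚ → invℕ n ≡ u
invℕ-unique n {u} u*n≡1 = begin
  invℕ n                       ≡⟨ ℚ.*-identityʳ (invℕ n) ⟨
  invℕ n * 1ℚ                  ≡⟨ cong (invℕ n *_) u*n≡1 ⟨
  invℕ n * (u * ℕ→ℚ n)         ≡⟨ solve 3 (λ a b c → a :* (b :* c) := b :* (a :* c)) refl (invℕ n) u (ℕ→ℚ n) ⟩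
  u * (invℕ n * ℕ→ℚ n)         ≡⟨ cong (u *_) (invℕ-inverseˡ n) ⟩
  u * 1ℚ                       ≡⟨ ℚ.*-identityʳ u ⟩
  u                            ∎

invℕ-^ : ∀ m j .{{_ : NonZero m}} → invℕ (m ^ j) ≡ invℕ m ^ℚ j
invℕ-^ m j = invℕ-unique (m ^ j) {{m^n≢0 m j}} (begin
  (invℕ m ^ℚ j) * ℕ→ℚ (m ^ j)        ≡⟨ cong ((invℕ m ^ℚ j) *_) (ℕ→ℚ-^ m j) ⟩
  (invℕ m ^ℚ j) * (ℕ→ℚ m ^ℚ j)       ≡⟨ ^ℚ-distrib-* (invℕ m) (ℕ→ℚ m) j ⟨
  (invℕ m * ℕ→ℚ m) ^ℚ j              ≡⟨ cong (_^ℚ j) (invℕ-inverseˡ m) ⟩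
  1ℚ ^ℚ j                            ≡⟨ 1^ℚ j ⟩
  1ℚ                                 ∎)

invℕ-!-suc : ∀ k → ℕ→ℚ (suc k) * invℕ (suc k !) ≡ invℕ (k !)
invℕ-!-suc k = sym (invℕ-unique (k !) {{k !≢0}} (begin
  (ℕ→ℚ (suc k) * invℕ (suc k !)) * ℕ→ℚ (k !)   ≡⟨ solve 3 (λ a b c → (a :* b) :* c := b :* (a :* c)) refl (ℕ→ℚ (suc k)) (invℕ (suc k !)) (ℕ→ℚ (k !)) ⟩
  invℕ (suc k !) * (ℕ→ℚ (suc k) * ℕ→ℚ (k !))   ≡⟨ cong (invℕ (suc k !) *_) (ℕ→ℚ-* (suc k) (k !)) ⟨
  invℕ (suc k !) * ℕ→ℚ (suc k !)               ≡⟨ invℕ-inverseˡ (suc k !) {{suc k !≢0}} ⟩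
  1ℚ                                           ∎))

invℕ-*-cancelˡ : ∀ n .{{_ : NonZero n}} x → invℕ n * (ℕ→ℚ n * x) ≡ x
invℕ-*-cancelˡ n x = begin
  invℕ n * (ℕ→ℚ n * x)   ≡⟨ ℚ.*-assoc (invℕ n) (ℕ→ℚ n) x ⟨
  (invℕ n * ℕ→ℚ n) * x   ≡⟨ cong (_* x) (invℕ-inverseˡ n) ⟩
  1ℚ * x                 ≡⟨ ℚ.*-identityˡ x ⟩
  x                      ∎

ℕ→ℚ-*-cancelˡ : ∀ n .{{_ : NonZero n}} {x y} → ℕ→ℚ n * x ≡ ℕ→ℚ n * y → x ≡ y
ℕ→ℚ-*-cancelˡ n {x} {y} eq = begin
  x                      ≡⟨ invℕ-*-cancelˡ n x ⟨
  invℕ n * (ℕ→ℚ n * x)   ≡⟨ cong (invℕ n *_) eq ⟩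
  invℕ n * (ℕ→ℚ n * y)   ≡⟨ invℕ-*-cancelˡ n y ⟩
  y                      ∎

ℕ→ℚ-suc-* : ∀ k x → ℕ→ℚ (suc k) * x ≡ x + ℕ→ℚ k * x
ℕ→ℚ-suc-* k x = trans (cong (_* x) (ℕ→ℚ-suc k))
  (solve 2 (λ a x → (con 1ℚ :+ a) :* x := x :+ a :* x) refl (ℕ→ℚ k) x)

-- Formal power series over ℚ

Series : Set
Series = ℕ → ℚ

infixl 6 _⊕_
infixl 7 _∗_
infixr 8 _·_

_⊕_ : Series → Series → Series
(u ⊕ v) i = u i + v i

_·_ : ℚ → Series → Series
(c · u) i = c * u i

tail : Series → Series
tail u i = u (suc i)

shift : Series → Series
shift v zero    = 0ℚ
shift v (suc k) = v k

θ : Series → Series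
θ u k = ℕ→ℚ k * u k

𝟙 : Series
𝟙 zero    = 1ℚ
𝟙 (suc k) = 0ℚ

-- Cauchy product: (u ∗ v) k = Σ_{i ≤ k} u i * v (k ∸ i), peeling off the term i = 0
_∗_ : Series → Series → Series
(u ∗ v) zero    = u 0 * v 0
(u ∗ v) (suc k) = u 0 * v (suc k) + (tail u ∗ v) k

∗-cong-upTo : ∀ {u u′ v v′} k → (∀ i → i ≤ k → u i ≡ u′ i) → (∀ i → i ≤ k → v i ≡ v′ i) →
              (u ∗ v) k ≡ (u′ ∗ v′) k
∗-cong-upTo zero    u≡u′ v≡v′ = cong₂ _*_ (u≡u′ 0 z≤n) (v≡v′ 0 z≤n)
∗-cong-upTo (suc k) u≡u′ v≡v′ = cong₂ _+_
  (cong₂ _*_ (u≡u′ 0 z≤n) (v≡v′ (suc k) ℕ.≤-refl))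
  (∗-cong-upTo k (λ i i≤k → u≡u′ (suc i) (s≤s i≤k)) (λ i i≤k → v≡v′ i (ℕ.m≤n⇒m≤1+n i≤k)))

∗-congˡ : ∀ {u u′} v → u ≗ u′ → u ∗ v ≗ u′ ∗ v
∗-congˡ v u≗u′ k = ∗-cong-upTo k (λ i _ → u≗u′ i) (λ _ _ → refl)

∗-congʳ : ∀ u {v v′} → v ≗ v′ → u ∗ v ≗ u ∗ v′
∗-congʳ u v≗v′ k = ∗-cong-upTo k (λ _ _ → refl) (λ i _ → v≗v′ i)

∗-zeroˡ : ∀ {u} v → (∀ i → u i ≡ 0ℚ) → ∀ k → (u ∗ v) k ≡ 0ℚ
∗-zeroˡ v u≡0 zero    rewrite u≡0 0 = ℚ.*-zeroˡ (v 0)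
∗-zeroˡ v u≡0 (suc k) rewrite u≡0 0 | ∗-zeroˡ v (λ i → u≡0 (suc i)) k =
  trans (ℚ.+-identityʳ _) (ℚ.*-zeroˡ (v (suc k)))

∗-zeroʳ-upTo : ∀ u {v} k → (∀ i → i ≤ k → v i ≡ 0ℚ) → (u ∗ v) k ≡ 0ℚ
∗-zeroʳ-upTo u zero    v≡0 rewrite v≡0 0 z≤n = ℚ.*-zeroʳ (u 0)
∗-zeroʳ-upTo u (suc k) v≡0
  rewrite v≡0 (suc k) ℕ.≤-refl | ∗-zeroʳ-upTo (tail u) k (λ i i≤k → v≡0 i (ℕ.m≤n⇒m≤1+n i≤k)) =
  trans (ℚ.+-identityʳ _) (ℚ.*-zeroʳ (u 0))

𝟙-∗ : ∀ v → 𝟙 ∗ v ≗ v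
𝟙-∗ v zero    = ℚ.*-identityˡ (v 0)
𝟙-∗ v (suc k) = trans (cong₂ _+_ (ℚ.*-identityˡ (v (suc k))) (∗-zeroˡ v (λ _ → refl) k))
                      (ℚ.+-identityʳ (v (suc k)))

∗-distribʳ-⊕ : ∀ u v w → (u ⊕ v) ∗ w ≗ u ∗ w ⊕ v ∗ w
∗-distribʳ-⊕ u v w zero    = ℚ.*-distribʳ-+ (w 0) (u 0) (v 0)
∗-distribʳ-⊕ u v w (suc k) rewrite ∗-distribʳ-⊕ (tail u) (tail v) w k =
  solve 5 (λ a b c d e → (a :+ b) :* c :+ (d :+ e) := (a :* c :+ d) :+ (b :* c :+ e))
    refl (u 0) (v 0) (w (suc k)) ((tail u ∗ w) k) ((tail v ∗ w) k)

∗-distribˡ-⊕ : ∀ u v w → u ∗ (v ⊕ w) ≗ u ∗ v ⊕ u ∗ w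
∗-distribˡ-⊕ u v w zero    = ℚ.*-distribˡ-+ (u 0) (v 0) (w 0)
∗-distribˡ-⊕ u v w (suc k) rewrite ∗-distribˡ-⊕ (tail u) v w k =
  solve 5 (λ a b c d e → a :* (b :+ c) :+ (d :+ e) := (a :* b :+ d) :+ (a :* c :+ e))
    refl (u 0) (v (suc k)) (w (suc k)) ((tail u ∗ v) k) ((tail u ∗ w) k)

∗-·ˡ : ∀ c u v → (c · u) ∗ v ≗ c · (u ∗ v)
∗-·ˡ c u v zero    = ℚ.*-assoc c (u 0) (v 0)
∗-·ˡ c u v (suc k) rewrite ∗-·ˡ c (tail u) v k =
  solve 4 (λ c a b d → c :* a :* b :+ c :* d := c :* (a :* b :+ d)) refl c (u 0) (v (suc k)) ((tail u ∗ v) k)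

∗-·ʳ : ∀ c u v → u ∗ (c · v) ≗ c · (u ∗ v)
∗-·ʳ c u v zero    = solve 3 (λ c a b → a :* (c :* b) := c :* (a :* b)) refl c (u 0) (v 0)
∗-·ʳ c u v (suc k) rewrite ∗-·ʳ c (tail u) v k =
  solve 4 (λ c a b d → a :* (c :* b) :+ c :* d := c :* (a :* b :+ d)) refl c (u 0) (v (suc k)) ((tail u ∗ v) k)

∗-shiftˡ : ∀ u v → shift u ∗ v ≗ shift (u ∗ v)
∗-shiftˡ u v zero    = ℚ.*-zeroˡ (v 0)
∗-shiftˡ u v (suc k) = trans (cong (_+ (u ∗ v) k) (ℚ.*-zeroˡ (v (suc k)))) (ℚ.+-identityˡ ((u ∗ v) k))

∗-shiftʳ : ∀ u v → u ∗ shift v ≗ shift (u ∗ v)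
∗-shiftʳ u v zero          = ℚ.*-zeroʳ (u 0)
∗-shiftʳ u v (suc zero)    = trans (cong (u 0 * v 0 +_) (ℚ.*-zeroʳ (u 1))) (ℚ.+-identityʳ (u 0 * v 0))
∗-shiftʳ u v (suc (suc k)) = cong (u 0 * v (suc k) +_) (∗-shiftʳ (tail u) v (suc k))

∗-tailˡ : ∀ u v → u 0 ≡ 0ℚ → ∀ k → (u ∗ v) (suc k) ≡ (tail u ∗ v) k
∗-tailˡ u v u₀≡0 k = trans (cong (λ a → a * v (suc k) + (tail u ∗ v) k) u₀≡0)
  (trans (cong (_+ (tail u ∗ v) k) (ℚ.*-zeroˡ (v (suc k)))) (ℚ.+-identityˡ _))

∗-snoc : ∀ u v k → (u ∗ v) (suc k) ≡ (u ∗ tail v) k + u (suc k) * v 0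
∗-snoc u v zero    = refl
∗-snoc u v (suc k) rewrite ∗-snoc (tail u) v k =
  sym (ℚ.+-assoc (u 0 * v (suc (suc k))) ((tail u ∗ tail v) k) (u (suc (suc k)) * v 0))

∗-comm : ∀ u v → u ∗ v ≗ v ∗ u
∗-comm u v zero    = ℚ.*-comm (u 0) (v 0)
∗-comm u v (suc k) rewrite ∗-comm (tail u) v k | ∗-snoc v u k =
  trans (ℚ.+-comm (u 0 * v (suc k)) ((v ∗ tail u) k)) (cong ((v ∗ tail u) k +_) (ℚ.*-comm (u 0) (v (suc k))))

∗-unfold : ∀ u v → u ∗ v ≗ u 0 · v ⊕ shift (tail u ∗ v)
∗-unfold u v zero    = sym (ℚ.+-identityʳ (u 0 * v 0))
∗-unfold u v (suc k) = refl

∗-assoc : ∀ u v w → u ∗ (v ∗ w) ≗ (u ∗ v) ∗ w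
∗-assoc u v w zero    = sym (ℚ.*-assoc (u 0) (v 0) (w 0))
∗-assoc u v w (suc k) = begin
  u 0 * (v ∗ w) (suc k) + (tail u ∗ (v ∗ w)) k
    ≡⟨ cong (u 0 * (v ∗ w) (suc k) +_) (∗-assoc (tail u) v w k) ⟩
  u 0 * (v ∗ w) (suc k) + ((tail u ∗ v) ∗ w) k
    ≡⟨ cong₂ _+_ (∗-·ˡ (u 0) v w (suc k)) (∗-shiftˡ (tail u ∗ v) w (suc k)) ⟨
  ((u 0 · v) ∗ w) (suc k) + (shift (tail u ∗ v) ∗ w) (suc k)
    ≡⟨ ∗-distribʳ-⊕ (u 0 · v) (shift (tail u ∗ v)) w (suc k) ⟨
  ((u 0 · v ⊕ shift (tail u ∗ v)) ∗ w) (suc k)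
    ≡⟨ ∗-congˡ w (∗-unfold u v) (suc k) ⟨
  ((u ∗ v) ∗ w) (suc k) ∎

∗-lcomm : ∀ u v w → u ∗ (v ∗ w) ≗ v ∗ (u ∗ w)
∗-lcomm u v w k = begin
  (u ∗ (v ∗ w)) k  ≡⟨ ∗-assoc u v w k ⟩
  ((u ∗ v) ∗ w) k  ≡⟨ ∗-congˡ w (∗-comm u v) k ⟩
  ((v ∗ u) ∗ w) k  ≡⟨ ∗-assoc v u w k ⟨
  (v ∗ (u ∗ w)) k  ∎

tail-θ : ∀ u → tail (θ u) ≗ tail u ⊕ θ (tail u)
tail-θ u i = ℕ→ℚ-suc-* i (u (suc i))

θ-∗ : ∀ u v → θ (u ∗ v) ≗ θ u ∗ v ⊕ u ∗ θ v
θ-∗ u v zero    = solve 2 (λ a b → con 0ℚ :* (a :* b) := con 0ℚ :* a :* b :+ a :* (con 0ℚ :* b)) refl (u 0) (v 0)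
θ-∗ u v (suc k) = begin
  s * (u 0 * v (suc k) + C)              ≡⟨ solve 4 (λ s a b C → s :* (a :* b :+ C) := a :* (s :* b) :+ s :* C) refl s (u 0) (v (suc k)) C ⟩
  u 0 * θ v (suc k) + s * C              ≡⟨ cong (u 0 * θ v (suc k) +_) (ℕ→ℚ-suc-* k C) ⟩
  u 0 * θ v (suc k) + (C + θ (tail u ∗ v) k)
    ≡⟨ cong (λ x → u 0 * θ v (suc k) + (C + x)) (θ-∗ (tail u) v k) ⟩
  u 0 * θ v (suc k) + (C + ((θ (tail u) ∗ v) k + (tail u ∗ θ v) k))
    ≡⟨ cong (u 0 * θ v (suc k) +_) (ℚ.+-assoc C ((θ (tail u) ∗ v) k) ((tail u ∗ θ v) k)) ⟨
  u 0 * θ v (suc k) + ((C + (θ (tail u) ∗ v) k) + (tail u ∗ θ v) k)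
    ≡⟨ cong (λ x → u 0 * θ v (suc k) + (x + (tail u ∗ θ v) k)) (∗-distribʳ-⊕ (tail u) (θ (tail u)) v k) ⟨
  u 0 * θ v (suc k) + (((tail u ⊕ θ (tail u)) ∗ v) k + (tail u ∗ θ v) k)
    ≡⟨ cong (λ x → u 0 * θ v (suc k) + (x + (tail u ∗ θ v) k)) (∗-congˡ v (tail-θ u) k) ⟨
  u 0 * θ v (suc k) + ((tail (θ u) ∗ v) k + (tail u ∗ θ v) k)
    ≡⟨ solve 5 (λ a b w D E → a :* b :+ (D :+ E) := con 0ℚ :* a :* w :+ D :+ (a :* b :+ E))
         refl (u 0) (θ v (suc k)) (v (suc k)) ((tail (θ u) ∗ v) k) ((tail u ∗ θ v) k) ⟩
  (θ u ∗ v) (suc k) + (u ∗ θ v) (suc k)  ∎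
  where
  s = ℕ→ℚ (suc k)
  C = (tail u ∗ v) k

∗-vanishes-upTo : ∀ {u v} m → u 0 ≡ 0ℚ → (∀ i → i < m → v i ≡ 0ℚ) → ∀ k → k ≤ m → (u ∗ v) k ≡ 0ℚ
∗-vanishes-upTo {u} {v} m u₀≡0 v≡0 zero    _   rewrite u₀≡0 = ℚ.*-zeroˡ (v 0)
∗-vanishes-upTo {u} {v} m u₀≡0 v≡0 (suc k) k<m = trans (∗-tailˡ u v u₀≡0 k)
  (∗-zeroʳ-upTo (tail u) k (λ i i≤k → v≡0 i (ℕ.<-≤-trans (s≤s i≤k) k<m)))

coeff-addP : ∀ p q → coeff (addP p q) ≗ coeff p ⊕ coeff q
coeff-addP []      q       k       = sym (ℚ.+-identityˡ (coeff q k))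
coeff-addP (a ∷ p) []      k       = sym (ℚ.+-identityʳ (coeff (a ∷ p) k))
coeff-addP (a ∷ p) (b ∷ q) zero    = refl
coeff-addP (a ∷ p) (b ∷ q) (suc k) = coeff-addP p q k

coeff-scaleP : ∀ c p → coeff (scaleP c p) ≗ c · coeff p
coeff-scaleP c []      k       = sym (ℚ.*-zeroʳ c)
coeff-scaleP c (a ∷ p) zero    = refl
coeff-scaleP c (a ∷ p) (suc k) = coeff-scaleP c p k

coeff-mulP : ∀ p q → coeff (mulP p q) ≗ coeff p ∗ coeff q
coeff-mulP []      q k       = sym (∗-zeroˡ (coeff q) (λ _ → refl) k)
coeff-mulP (a ∷ p) q zero    = trans (coeff-addP (scaleP a q) (0ℚ ∷ mulP p q) 0)
  (trans (ℚ.+-identityʳ _) (coeff-scaleP a q 0))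
coeff-mulP (a ∷ p) q (suc k) = trans (coeff-addP (scaleP a q) (0ℚ ∷ mulP p q) (suc k))
  (cong₂ _+_ (coeff-scaleP a q (suc k)) (coeff-mulP p q k))

coeff-mulP-linP : ∀ p c → coeff (mulP p (linP c)) ≗ c · coeff p ⊕ shift (coeff p)
coeff-mulP-linP p c zero    = trans (coeff-mulP p (linP c) 0)
  (trans (ℚ.*-comm (coeff p 0) c) (sym (ℚ.+-identityʳ (c * coeff p 0))))
coeff-mulP-linP p c (suc k) = begin
  coeff (mulP p (linP c)) (suc k)          ≡⟨ coeff-mulP p (linP c) (suc k) ⟩
  (coeff p ∗ coeff (linP c)) (suc k)       ≡⟨ ∗-comm (coeff p) (coeff (linP c)) (suc k) ⟩
  c * coeff p (suc k) + (coeff (1ℚ ∷ []) ∗ coeff p) k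
    ≡⟨ cong (c * coeff p (suc k) +_) (trans (∗-congˡ (coeff p) 𝟙≗ k) (𝟙-∗ (coeff p) k)) ⟩
  c * coeff p (suc k) + coeff p k          ∎
  where
  𝟙≗ : coeff (1ℚ ∷ []) ≗ 𝟙
  𝟙≗ zero    = refl
  𝟙≗ (suc k) = refl

-- θ X = t · (β ∗ X), compared in degrees 1, …, K
EulerEquation : Series → ℕ → Series → Set
EulerEquation β K X = ∀ k → k < K → ℕ→ℚ (suc k) * X (suc k) ≡ (β ∗ X) k

EulerEquation-cong : ∀ {β β′ K X} → (∀ i → i < K → β i ≡ β′ i) → EulerEquation β K X → EulerEquation β′ K X
EulerEquation-cong β≡β′ ode k k<K =
  trans (ode k k<K) (∗-cong-upTo k (λ i i≤k → β≡β′ i (ℕ.≤-<-trans i≤k k<K)) (λ _ _ → refl))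

EulerEquation-unique : ∀ {β K X Y} → EulerEquation β K X → EulerEquation β K Y → X 0 ≡ Y 0 →
                       ∀ k → k ≤ K → X k ≡ Y k
EulerEquation-unique {β} {K} {X} {Y} odeX odeY X₀≡Y₀ k k≤K = agree k k≤K k ℕ.≤-refl
  where
  agree : ∀ k → k ≤ K → ∀ i → i ≤ k → X i ≡ Y i
  agree zero    _   .zero z≤n = X₀≡Y₀
  agree (suc k) k<K i     i≤1+k with ℕ.m≤n⇒m<n∨m≡n i≤1+k
  ... | inj₁ (s≤s i≤k) = agree k (ℕ.<⇒≤ k<K) i i≤k
  ... | inj₂ refl      = ℕ→ℚ-*-cancelˡ (suc k) (begin
    ℕ→ℚ (suc k) * X (suc k)  ≡⟨ odeX k k<K ⟩
    (β ∗ X) k                ≡⟨ ∗-cong-upTo k (λ _ _ → refl) (agree k (ℕ.<⇒≤ k<K)) ⟩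
    (β ∗ Y) k                ≡⟨ odeY k k<K ⟨
    ℕ→ℚ (suc k) * Y (suc k)  ∎)

-- The truncated exponential

module TruncatedExp (p : Poly) (p₀≡0 : coeff p 0 ≡ 0ℚ) where

  π : Series
  π = coeff p

  pow : ℕ → Series
  pow m = coeff (powP p m)

  exp : ℕ → Series
  exp K = coeff (expTrunc K p)

  θπ₀≡0 : θ π 0 ≡ 0ℚ
  θπ₀≡0 = ℚ.*-zeroˡ (π 0)

  pow-vanishes : ∀ m k → k < m → pow m k ≡ 0ℚ
  pow-vanishes (suc m) k (s≤s k≤m) =
    trans (coeff-mulP p (powP p m) k) (∗-vanishes-upTo m p₀≡0 (pow-vanishes m) k k≤m)

  θ-pow-zero : ∀ k → θ (pow 0) k ≡ 0ℚ
  θ-pow-zero zero    = ℚ.*-zeroˡ 1ℚ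
  θ-pow-zero (suc k) = ℚ.*-zeroʳ (ℕ→ℚ (suc k))

  θ-pow   : ∀ m → θ (pow (suc m)) ≗ ℕ→ℚ (suc m) · (θ π ∗ pow m)
  π∗θ-pow : ∀ m → π ∗ θ (pow m) ≗ ℕ→ℚ m · (θ π ∗ pow m)

  θ-pow m k = begin
    ℕ→ℚ k * pow (suc m) k                      ≡⟨ cong (ℕ→ℚ k *_) (coeff-mulP p (powP p m) k) ⟩
    θ (π ∗ pow m) k                            ≡⟨ θ-∗ π (pow m) k ⟩
    (θ π ∗ pow m) k + (π ∗ θ (pow m)) k        ≡⟨ cong ((θ π ∗ pow m) k +_) (π∗θ-pow m k) ⟩
    (θ π ∗ pow m) k + ℕ→ℚ m * (θ π ∗ pow m) k  ≡⟨ ℕ→ℚ-suc-* m ((θ π ∗ pow m) k) ⟨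
    ℕ→ℚ (suc m) * (θ π ∗ pow m) k              ∎

  π∗θ-pow zero    k = trans (∗-zeroʳ-upTo π k (λ i _ → θ-pow-zero i)) (sym (ℚ.*-zeroˡ ((θ π ∗ pow 0) k)))
  π∗θ-pow (suc m) k = begin
    (π ∗ θ (pow (suc m))) k                ≡⟨ ∗-congʳ π (θ-pow m) k ⟩
    (π ∗ (s · (θ π ∗ pow m))) k            ≡⟨ ∗-·ʳ s π (θ π ∗ pow m) k ⟩
    s * (π ∗ (θ π ∗ pow m)) k              ≡⟨ cong (s *_) (∗-lcomm π (θ π) (pow m) k) ⟩
    s * (θ π ∗ (π ∗ pow m)) k              ≡⟨ cong (s *_) (∗-congʳ (θ π) (coeff-mulP p (powP p m)) k) ⟨
    s * (θ π ∗ pow (suc m)) k              ∎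
    where s = ℕ→ℚ (suc m)

  exp-suc : ∀ K → exp (suc K) ≗ exp K ⊕ invℕ (suc K !) · pow (suc K)
  exp-suc K k = trans (coeff-addP (expTrunc K p) _ k)
    (cong (exp K k +_) (coeff-scaleP (invℕ (suc K !)) (powP p (suc K)) k))

  θπ∗exp-suc : ∀ K → θ π ∗ exp (suc K) ≗ θ π ∗ exp K ⊕ invℕ (suc K !) · (θ π ∗ pow (suc K))
  θπ∗exp-suc K k = begin
    (θ π ∗ exp (suc K)) k                          ≡⟨ ∗-congʳ (θ π) (exp-suc K) k ⟩
    (θ π ∗ (exp K ⊕ c · pow (suc K))) k            ≡⟨ ∗-distribˡ-⊕ (θ π) (exp K) (c · pow (suc K)) k ⟩
    (θ π ∗ exp K) k + (θ π ∗ (c · pow (suc K))) k  ≡⟨ cong ((θ π ∗ exp K) k +_) (∗-·ʳ c (θ π) (pow (suc K)) k) ⟩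
    (θ π ∗ exp K) k + c * (θ π ∗ pow (suc K)) k    ∎
    where c = invℕ (suc K !)

  θ-exp-step : ∀ K → θ (exp (suc K)) ≗ θ (exp K) ⊕ invℕ (K !) · (θ π ∗ pow K)
  θ-exp-step K k = begin
    ℕ→ℚ k * exp (suc K) k                               ≡⟨ cong (ℕ→ℚ k *_) (exp-suc K k) ⟩
    ℕ→ℚ k * (exp K k + c * pow (suc K) k)               ≡⟨ solve 4 (λ a e c q → a :* (e :+ c :* q) := a :* e :+ c :* (a :* q))
                                                             refl (ℕ→ℚ k) (exp K k) c (pow (suc K) k) ⟩
    θ (exp K) k + c * θ (pow (suc K)) k                 ≡⟨ cong (λ x → θ (exp K) k + c * x) (θ-pow K k) ⟩
    θ (exp K) k + c * (ℕ→ℚ (suc K) * (θ π ∗ pow K) k)   ≡⟨ cong (θ (exp K) k +_) (ℚ.*-assoc c _ _) ⟨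
    θ (exp K) k + (c * ℕ→ℚ (suc K)) * (θ π ∗ pow K) k   ≡⟨ cong (λ x → θ (exp K) k + x * (θ π ∗ pow K) k)
                                                             (trans (ℚ.*-comm c _) (invℕ-!-suc K)) ⟩
    θ (exp K) k + invℕ (K !) * (θ π ∗ pow K) k          ∎
    where c = invℕ (suc K !)

  θ-exp-suc : ∀ K → θ (exp (suc K)) ≗ θ π ∗ exp K
  θ-exp-suc zero    k = begin
    θ (exp 1) k                            ≡⟨ θ-exp-step 0 k ⟩
    θ (pow 0) k + 1ℚ * (θ π ∗ pow 0) k     ≡⟨ cong₂ _+_ (θ-pow-zero k) (ℚ.*-identityˡ ((θ π ∗ pow 0) k)) ⟩
    0ℚ + (θ π ∗ pow 0) k                   ≡⟨ ℚ.+-identityˡ ((θ π ∗ pow 0) k) ⟩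
    (θ π ∗ exp 0) k                        ∎
  θ-exp-suc (suc K) k = begin
    θ (exp (suc (suc K))) k                                     ≡⟨ θ-exp-step (suc K) k ⟩
    θ (exp (suc K)) k + invℕ (suc K !) * (θ π ∗ pow (suc K)) k  ≡⟨ cong (_+ invℕ (suc K !) * (θ π ∗ pow (suc K)) k) (θ-exp-suc K k) ⟩
    (θ π ∗ exp K) k + invℕ (suc K !) * (θ π ∗ pow (suc K)) k    ≡⟨ θπ∗exp-suc K k ⟨
    (θ π ∗ exp (suc K)) k                                       ∎

  θ-exp : ∀ K k → k ≤ K → θ (exp K) k ≡ (θ π ∗ exp K) k
  θ-exp zero    .zero z≤n   = trans (θ-pow-zero 0) (sym (trans (cong (_* 1ℚ) θπ₀≡0) (ℚ.*-zeroˡ 1ℚ)))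
  θ-exp (suc K) k     k≤1+K = begin
    θ (exp (suc K)) k                                ≡⟨ θ-exp-suc K k ⟩
    (θ π ∗ exp K) k                                  ≡⟨ ℚ.+-identityʳ _ ⟨
    (θ π ∗ exp K) k + 0ℚ                             ≡⟨ cong ((θ π ∗ exp K) k +_) (trans (cong (c *_) vanishes) (ℚ.*-zeroʳ c)) ⟨
    (θ π ∗ exp K) k + c * (θ π ∗ pow (suc K)) k      ≡⟨ θπ∗exp-suc K k ⟨
    (θ π ∗ exp (suc K)) k                            ∎
    where
    c = invℕ (suc K !)
    vanishes : (θ π ∗ pow (suc K)) k ≡ 0ℚ
    vanishes = ∗-vanishes-upTo (suc K) θπ₀≡0 (pow-vanishes (suc K)) k k≤1+K

  exp-constant : ∀ K → exp K 0 ≡ 1ℚ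
  exp-constant zero    = refl
  exp-constant (suc K) = begin
    exp (suc K) 0                        ≡⟨ exp-suc K 0 ⟩
    exp K 0 + c * pow (suc K) 0          ≡⟨ cong₂ (λ a b → a + c * b) (exp-constant K) (pow-vanishes (suc K) 0 (s≤s z≤n)) ⟩
    1ℚ + c * 0ℚ                          ≡⟨ solve 1 (λ c → con 1ℚ :+ c :* con 0ℚ := con 1ℚ) refl c ⟩
    1ℚ                                   ∎
    where c = invℕ (suc K !)

  exp-EulerEquation : ∀ K → EulerEquation (tail (θ π)) K (exp K)
  exp-EulerEquation K k k<K = trans (θ-exp K (suc k) k<K) (∗-tailˡ (θ π) (exp K) θπ₀≡0 k)

-- Newton's identities for 1, 1/2, …, 1/n

-- ∏_{m ≤ n} (1 + t/m), whose coefficients are e_k(1, 1/2, …, 1/n)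
e : ℕ → Series
e zero    = 𝟙
e (suc n) = e n ⊕ invℕ (suc n) · shift (e n)

e-zero : ∀ n → e n 0 ≡ 1ℚ
e-zero zero    = refl
e-zero (suc n) = trans (cong₂ _+_ (e-zero n) (ℚ.*-zeroʳ (invℕ (suc n)))) (ℚ.+-identityʳ 1ℚ)

e-vanishes : ∀ n r → n < r → e n r ≡ 0ℚ
e-vanishes zero    (suc r) _         = refl
e-vanishes (suc n) (suc r) (s≤s n<r) =
  trans (cong₂ (λ a b → a + invℕ (suc n) * b) (e-vanishes n (suc r) (ℕ.m≤n⇒m≤1+n n<r)) (e-vanishes n r n<r))
        (trans (ℚ.+-identityˡ _) (ℚ.*-zeroʳ (invℕ (suc n))))

-- the coefficients of (θ log (e n)) / t
signedPowerSum : ℕ → Series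
signedPowerSum n j = sgn j * H n (suc j)

-- the coefficients of (θ log (1 + c t)) / t = c / (1 + c t)
geometric : ℚ → Series
geometric c j = sgn j * c ^ℚ suc j

signedPowerSum-suc : ∀ n → signedPowerSum (suc n) ≗ signedPowerSum n ⊕ geometric (invℕ (suc n))
signedPowerSum-suc n j = begin
  sgn j * (H n (suc j) + invℕ (suc n ^ suc j))      ≡⟨ cong (λ x → sgn j * (H n (suc j) + x)) (invℕ-^ (suc n) (suc j)) ⟩
  sgn j * (H n (suc j) + invℕ (suc n) ^ℚ suc j)     ≡⟨ ℚ.*-distribˡ-+ (sgn j) _ _ ⟩
  signedPowerSum n j + geometric (invℕ (suc n)) j   ∎

tail-geometric : ∀ c → tail (geometric c) ≗ (- c) · geometric c
tail-geometric c j = solve 3 (λ c s q → (con (- 1ℚ) :* s) :* (c :* q) := (:- c) :* (s :* q)) refl c (sgn j) (c ^ℚ suc j)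

geometric-∗-factor : ∀ c g → geometric c ∗ (g ⊕ c · shift g) ≗ c · g
geometric-∗-factor c g zero    = solve 2 (λ c g₀ → con 1ℚ :* (c :* con 1ℚ) :* (g₀ :+ c :* con 0ℚ) := c :* g₀) refl c (g 0)
geometric-∗-factor c g (suc k) = begin
  geometric c 0 * X (suc k) + (tail (geometric c) ∗ X) k   ≡⟨ cong (geometric c 0 * X (suc k) +_) (∗-congˡ X (tail-geometric c) k) ⟩
  geometric c 0 * X (suc k) + ((- c) · geometric c ∗ X) k  ≡⟨ cong (geometric c 0 * X (suc k) +_) (∗-·ˡ (- c) (geometric c) X k) ⟩
  geometric c 0 * X (suc k) + (- c) * (geometric c ∗ X) k  ≡⟨ cong (λ x → geometric c 0 * X (suc k) + (- c) * x) (geometric-∗-factor c g k) ⟩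
  geometric c 0 * X (suc k) + (- c) * (c * g k)            ≡⟨ solve 3 (λ c g₁ g₀ → con 1ℚ :* (c :* con 1ℚ) :* (g₁ :+ c :* g₀) :+ (:- c) :* (c :* g₀) := c :* g₁)
                                                                refl c (g (suc k)) (g k) ⟩
  c * g (suc k)                                            ∎
  where X = g ⊕ c · shift g

∗-shift-θ : ∀ β X → (∀ k → ℕ→ℚ (suc k) * X (suc k) ≡ (β ∗ X) k) → β ∗ shift X ≗ θ X
∗-shift-θ β X ode zero    = trans (∗-shiftʳ β X 0) (sym (ℚ.*-zeroˡ (X 0)))
∗-shift-θ β X ode (suc k) = trans (∗-shiftʳ β X (suc k)) (sym (ode k))

newton : ∀ n k → ℕ→ℚ (suc k) * e n (suc k) ≡ (signedPowerSum n ∗ e n) k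
newton zero    k = trans (ℚ.*-zeroʳ (ℕ→ℚ (suc k))) (sym (∗-zeroˡ (e 0) (λ j → ℚ.*-zeroʳ (sgn j)) k))
newton (suc n) k = sym (begin
  (signedPowerSum (suc n) ∗ e (suc n)) k
    ≡⟨ ∗-congˡ (e (suc n)) (signedPowerSum-suc n) k ⟩
  ((P ⊕ geometric c) ∗ (g ⊕ c · shift g)) k
    ≡⟨ ∗-distribʳ-⊕ P (geometric c) (g ⊕ c · shift g) k ⟩
  (P ∗ (g ⊕ c · shift g)) k + (geometric c ∗ (g ⊕ c · shift g)) k
    ≡⟨ cong₂ _+_ (∗-distribˡ-⊕ P g (c · shift g) k) (geometric-∗-factor c g k) ⟩
  (P ∗ g) k + (P ∗ (c · shift g)) k + c * g k
    ≡⟨ cong (λ x → (P ∗ g) k + x + c * g k) (∗-·ʳ c P (shift g) k) ⟩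
  (P ∗ g) k + c * (P ∗ shift g) k + c * g k
    ≡⟨ cong₂ (λ x y → x + c * y + c * g k) (newton n k) (sym (∗-shift-θ P g (newton n) k)) ⟨
  s * g (suc k) + c * (ℕ→ℚ k * g k) + c * g k
    ≡⟨ solve 5 (λ s a g₁ c g₀ → s :* g₁ :+ c :* (a :* g₀) :+ c :* g₀ := s :* g₁ :+ c :* (g₀ :+ a :* g₀))
         refl s (ℕ→ℚ k) (g (suc k)) c (g k) ⟩
  s * g (suc k) + c * (g k + ℕ→ℚ k * g k)
    ≡⟨ cong (λ x → s * g (suc k) + c * x) (ℕ→ℚ-suc-* k (g k)) ⟨
  s * g (suc k) + c * (s * g k)
    ≡⟨ solve 4 (λ s g₁ c g₀ → s :* g₁ :+ c :* (s :* g₀) := s :* (g₁ :+ c :* g₀)) refl s (g (suc k)) c (g k) ⟩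
  s * e (suc n) (suc k) ∎)
  where
  P = signedPowerSum n
  g = e n
  c = invℕ (suc n)
  s = ℕ→ℚ (suc k)

fTerms : (ℕ → ℚ) → ℕ → ℕ → Poly
fTerms x j zero    = []
fTerms x j (suc m) = (x j * invℕ (j !)) ∷ fTerms x (suc j) m

coeff-fTerms : ∀ x j m i → i < m → coeff (fTerms x j m) i ≡ x (j ℕ.+ i) * invℕ ((j ℕ.+ i) !)
coeff-fTerms x j (suc m) zero    _         rewrite ℕ.+-identityʳ j = refl
coeff-fTerms x j (suc m) (suc i) (s≤s i<m) rewrite ℕ.+-suc j i = coeff-fTerms x (suc j) m i i<m

fTerms-unique : ∀ x {F : ℕ → ℕ → Poly} → (∀ j → F j zero ≡ []) →
                (∀ j m → F j (suc m) ≡ (x j * invℕ (j !)) ∷ F (suc j) m) → ∀ j m → F j m ≡ fTerms x j m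
fTerms-unique x     F-zero F-suc j zero    = F-zero j
fTerms-unique x {F} F-zero F-suc j (suc m) =
  trans (F-suc j m) (cong (x j * invℕ (j !) ∷_) (fTerms-unique x {F} F-zero F-suc (suc j) m))

-- fPoly builds its list with a local function that cannot be named here; abstracting
-- over 1 and r lets unification solve for it as the family F of fTerms-unique.
fPoly-fTerms : ∀ r x → drop 1 (fPoly r x) ≡ fTerms x 1 r
fPoly-fTerms r x with fTerms-unique x (λ _ → refl) (λ _ _ → refl) | 1 | r
... | F≡fTerms | j | m = F≡fTerms j m

coeff-fPoly : ∀ r x i → i < r → coeff (fPoly r x) (suc i) ≡ x (suc i) * invℕ (suc i !)
coeff-fPoly r x i i<r = trans (cong (λ l → coeff l i) (fPoly-fTerms r x)) (coeff-fTerms x 1 r i i<r)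

harmonicBellArgs : ℕ → ℕ → ℚ
harmonicBellArgs n i = (sgn (i ∸ 1) * ℕ→ℚ ((i ∸ 1) !)) * H n i

θ-fPoly-harmonic : ∀ n r i → i < r → tail (θ (coeff (fPoly r (harmonicBellArgs n)))) i ≡ signedPowerSum n i
θ-fPoly-harmonic n r i i<r = begin
  s * coeff (fPoly r (harmonicBellArgs n)) (suc i)          ≡⟨ cong (s *_) (coeff-fPoly r (harmonicBellArgs n) i i<r) ⟩
  s * (((sgn i * ℕ→ℚ (i !)) * H n (suc i)) * invℕ (suc i !)) ≡⟨ solve 5 (λ s σ f h c → s :* (((σ :* f) :* h) :* c) := (σ :* h) :* ((s :* c) :* f))
                                                                   refl s (sgn i) (ℕ→ℚ (i !)) (H n (suc i)) (invℕ (suc i !)) ⟩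
  signedPowerSum n i * ((s * invℕ (suc i !)) * ℕ→ℚ (i !))    ≡⟨ cong (λ x → signedPowerSum n i * (x * ℕ→ℚ (i !))) (invℕ-!-suc i) ⟩
  signedPowerSum n i * (invℕ (i !) * ℕ→ℚ (i !))              ≡⟨ cong (signedPowerSum n i *_) (invℕ-inverseˡ (i !) {{i !≢0}}) ⟩
  signedPowerSum n i * 1ℚ                                    ≡⟨ ℚ.*-identityʳ (signedPowerSum n i) ⟩
  signedPowerSum n i                                         ∎
  where s = ℕ→ℚ (suc i)

Bel-harmonic : ∀ n r → Bel r (harmonicBellArgs n) ≡ ℕ→ℚ (r !) * e n r
Bel-harmonic n r = cong (ℕ→ℚ (r !) *_)
  (EulerEquation-unique
    (EulerEquation-cong (θ-fPoly-harmonic n r) (exp-EulerEquation r))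
    (λ k _ → newton n k)
    (trans (exp-constant r) (sym (e-zero n)))
    r ℕ.≤-refl)
  where open TruncatedExp (fPoly r (harmonicBellArgs n)) refl

Sλ-suc : ∀ l n → Sλ l (suc n) ≗ (ℕ→ℚ n * l) · Sλ l n ⊕ shift (Sλ l n)
Sλ-suc l n = coeff-mulP-linP (risingλ l n) (ℕ→ℚ n * l)

Sλ-suc-zero : ∀ l n → Sλ l (suc n) 0 ≡ 0ℚ
Sλ-suc-zero l zero    = trans (Sλ-suc l 0 0) (solve 1 (λ l → con 0ℚ :* l :* con 1ℚ :+ con 0ℚ := con 0ℚ) refl l)
Sλ-suc-zero l (suc n) = begin
  Sλ l (suc (suc n)) 0                     ≡⟨ Sλ-suc l (suc n) 0 ⟩
  (ℕ→ℚ (suc n) * l) * Sλ l (suc n) 0 + 0ℚ  ≡⟨ cong (λ x → (ℕ→ℚ (suc n) * l) * x + 0ℚ) (Sλ-suc-zero l n) ⟩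
  (ℕ→ℚ (suc n) * l) * 0ℚ + 0ℚ              ≡⟨ solve 1 (λ a → a :* con 0ℚ :+ con 0ℚ := con 0ℚ) refl (ℕ→ℚ (suc n) * l) ⟩
  0ℚ                                       ∎

-- n ∸ r = suc (n ∸ suc r) fails exactly when n ≤ r, where x is required to vanish.
^ℚ-∸-suc : ∀ l n r x → (n ≤ r → x ≡ 0ℚ) → l * (l ^ℚ (n ∸ suc r) * x) ≡ l ^ℚ (n ∸ r) * x
^ℚ-∸-suc l zero    r       x x≡0 rewrite x≡0 z≤n =
  trans (cong (l *_) (ℚ.*-zeroʳ 1ℚ)) (trans (ℚ.*-zeroʳ l) (sym (ℚ.*-zeroʳ (l ^ℚ (0 ∸ r)))))
^ℚ-∸-suc l (suc n) zero    x _   = sym (ℚ.*-assoc l (l ^ℚ n) x)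
^ℚ-∸-suc l (suc n) (suc r) x x≡0 = ^ℚ-∸-suc l n r x (λ n≤r → x≡0 (s≤s n≤r))

Sλ-e : ∀ l n r → Sλ l (suc n) r ≡ (ℕ→ℚ (n !) * l ^ℚ (suc n ∸ r)) * shift (e n) r
Sλ-e l n       zero          = trans (Sλ-suc-zero l n) (sym (ℚ.*-zeroʳ (ℕ→ℚ (n !) * l ^ℚ suc n)))
Sλ-e l zero    (suc zero)    = refl
Sλ-e l zero    (suc (suc r)) = refl
Sλ-e l (suc n) (suc r)       = begin
  Sλ l (suc (suc n)) (suc r)
    ≡⟨ Sλ-suc l (suc n) (suc r) ⟩
  (s * l) * Sλ l (suc n) (suc r) + Sλ l (suc n) r
    ≡⟨ cong₂ (λ a b → (s * l) * a + b) (Sλ-e l n (suc r)) (Sλ-e l n r) ⟩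
  (s * l) * ((F * l ^ℚ (n ∸ r)) * e n r) + (F * L) * shift (e n) r
    ≡⟨ solve 6 (λ s l F A E X → (s :* l) :* ((F :* A) :* E) :+ X := (s :* F) :* (l :* (A :* E)) :+ X)
         refl s l F (l ^ℚ (n ∸ r)) (e n r) ((F * L) * shift (e n) r) ⟩
  (s * F) * (l * (l ^ℚ (n ∸ r) * e n r)) + (F * L) * shift (e n) r
    ≡⟨ cong₂ (λ a b → (s * F) * a + b) (^ℚ-∸-suc l (suc n) r (e n r) (e-vanishes n r)) (sym (invℕ-*-cancelˡ (suc n) _)) ⟩
  (s * F) * (L * e n r) + invℕ (suc n) * (s * ((F * L) * shift (e n) r))
    ≡⟨ solve 6 (λ s F L E c X → (s :* F) :* (L :* E) :+ c :* (s :* ((F :* L) :* X)) := ((s :* F) :* L) :* (E :+ c :* X))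
         refl s F L (e n r) (invℕ (suc n)) (shift (e n) r) ⟩
  ((s * F) * L) * e (suc n) r
    ≡⟨ cong (λ a → (a * L) * e (suc n) r) (ℕ→ℚ-* (suc n) (n !)) ⟨
  (ℕ→ℚ (suc n !) * L) * e (suc n) r
    ∎
  where
  s = ℕ→ℚ (suc n)
  F = ℕ→ℚ (n !)
  L = l ^ℚ (suc n ∸ r)

theorem2 : (λ′ : ℚ) → λ′ ≢ 0ℚ → (n r : ℕ) → r ≤ n →
    Sλ λ′ (suc n) (suc r)
      ≡ ((ℕ→ℚ (n !) * invℕ (r !)) * (λ′ ^ℚ (n ∸ r)))
          * Bel r (λ i → (sgn (i ∸ 1) * ℕ→ℚ ((i ∸ 1) !)) * H n i)
theorem2 λ′ _ n r _ = begin
  Sλ λ′ (suc n) (suc r)                         ≡⟨ Sλ-e λ′ n (suc r) ⟩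
  (F * L) * e n r                               ≡⟨ cong ((F * L) *_) (invℕ-*-cancelˡ (r !) {{r !≢0}} (e n r)) ⟨
  (F * L) * (invℕ (r !) * (ℕ→ℚ (r !) * e n r))  ≡⟨ cong (λ x → (F * L) * (invℕ (r !) * x)) (Bel-harmonic n r) ⟨
  (F * L) * (invℕ (r !) * B)                    ≡⟨ solve 4 (λ F L c B → (F :* L) :* (c :* B) := ((F :* c) :* L) :* B)
                                                     refl F L (invℕ (r !)) B ⟩
  ((F * invℕ (r !)) * L) * B                    ∎
  where
  F = ℕ→ℚ (n !)
  L = λ′ ^ℚ (n ∸ r)
  B = Bel r (harmonicBellArgs n)
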